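{- Let $p$ be a prime, $k$ a finite extension of $\mathbb{F}_p$, and let $m$ be an integer with $p>m>2$. Let $z=\sum_{i\ge-m}a_it^i\in k((t))$ with $a_{ -m}\ne0$. Then there exists $t_1\in k((t))$ with $\operatorname{ord}_t(t_1)=1$ and $\psi_z(at_1^{\ell})=1$ for all $1\le\ell\le m-2$ and all $a\in k$.
   Context: $\Psi_p:\mathbb{F}_p\to\mathbb{C}^*$, $(x\bmod p)\mapsto\exp(2\pi ix/p)$. The standard additive character of $k((t))$ is $\psi(\sum_{i\ge N}b_it^i)=\Psi_p(\operatorname{Tr}_{k/\mathbb{F}_p}(b_{ -1}))$, and $\psi_z(x)=\psi(zx)$. -}

module Defs where

open import Level using (Level; _⊔_) renaming (suc to lsuc)
open import Algebra.Bundles using (CommutativeRing)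
open import Data.Nat using (ℕ; zero; suc; _∸_) renaming (_^_ to _^ℕ_; _+_ to _+ℕ_)
open import Data.Fin using (Fin)
open import Data.Integer using (ℤ; +_; -[1+_]) renaming (_+_ to _+ℤ_)
open import Data.Product using (∃)
open import Relation.Binary.PropositionalEquality using (_≡_)
open import Relation.Binary.Definitions using (Decidable)
open import Relation.Nullary using (¬_)

module RingOps {c ℓ : Level} (R : CommutativeRing c ℓ) where
  open CommutativeRing R

  fromℕ : ℕ → Carrier
  fromℕ zero    = 0#
  fromℕ (suc n) = 1# + fromℕ n

-- A finite field k of characteristic p, i.e. a finite extension of F_p,
-- with |k| = p ^ degree (degree = [k : F_p]).  Equality is the setoid
-- equality _≈_ of the underlying commutative ring.
record FiniteFieldOver (p : ℕ) (c ℓ : Level) : Set (lsuc (c ⊔ ℓ)) where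
  field
    field-ring : CommutativeRing c ℓ
  open CommutativeRing field-ring public
  field
    1≉0      : ¬ (1# ≈ 0#)
    inverse  : ∀ x → ¬ (x ≈ 0#) → ∃ λ y → (x * y) ≈ 1#
    _≟_      : Decidable _≈_
    degree   : ℕ
    enum     : Fin (p ^ℕ degree) → Carrier
    enum-inj : ∀ i j → enum i ≈ enum j → i ≡ j
    enum-sur : ∀ x → ∃ λ i → enum i ≈ x

    char-p : RingOps.fromℕ field-ring p ≈ 0#


module FF {p : ℕ} {c ℓ : Level} (K : FiniteFieldOver p c ℓ) where
  open FiniteFieldOver K

  pow : Carrier → ℕ → Carrier
  pow x zero    = 1#
  pow x (suc n) = x * pow x n

  sumTo : ℕ → (ℕ → Carrier) → Carrier
  sumTo zero    f = 0#
  sumTo (suc n) f = sumTo n f + f n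

  Tr : Carrier → Carrier
  Tr b = sumTo degree (λ j → pow b (p ^ℕ j))

  -- Laurent series Σ_{j ≥ 0} coeffs j · t^(j - shift) in k((t)).
  record Laurent : Set c where
    constructor laurent
    field
      shift  : ℕ
      coeffs : ℕ → Carrier

  coef : Laurent → ℤ → Carrier
  coef (laurent s c) e with e +ℤ (+ s)
  ... | + j      = c j
  ... | -[1+ _ ] = 0#

  _·L_ : Laurent → Laurent → Laurent
  laurent s c ·L laurent s' c' =
    laurent (s +ℕ s') (λ n → sumTo (suc n) (λ j → c j * c' (n ∸ j)))

  const : Carrier → Laurent
  const a = laurent 0 λ { zero → a ; (suc _) → 0# }

  powL : Laurent → ℕ → Laurent
  powL x zero    = const 1#
  powL x (suc n) = x ·L powL x n

  -- ψ(x) = Ψ_p(Tr(b_{-1})) = 1  ⇔  Tr(b_{-1}) = 0 in F_p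
  ψ≡1 : Laurent → Set ℓ
  ψ≡1 x = Tr (coef x (-[1+ 0 ])) ≈ 0#

  ψ[_]≡1 : Laurent → Laurent → Set ℓ
  ψ[ z ]≡1 x = ψ≡1 (z ·L x)

  HasOrd : Laurent → ℤ → Set ℓ
  HasOrd x e = (∀ i → i Data.Integer.< e → coef x i ≈ 0#) Data.Product.× ¬ (coef x e ≈ 0#)

module Submission where

-- Write z = t^(-m) · b(t) with b a power series, b(0) ≠ 0, and look
-- for t₁ = t · u(t) with u(0) = 1, so that ord t₁ = 1.  For a ∈ k the residue
-- (coefficient of t^(-1)) of z · a · t₁^ℓ is a · [t^n](b · u^ℓ) with ℓ + n = m - 1.
-- Hence it suffices to choose u with [t^n](b · u^ℓ) = 0 whenever ℓ, n ≥ 1 and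
-- ℓ + n = m - 1; then Tr of the residue is 0 and ψ_z(a t₁^ℓ) = Ψ_p(0) = 1.
-- Put N = m - 1 and E_n(u) = [t^n](b · u^(N-n)).  The coefficient u_n enters E_n(u)
-- linearly with slope b(0)·(N-n), and otherwise E_n(u) only involves u_0 … u_(n-1);
-- since 0 < N-n < p the slope is invertible in k, so u_1, u_2, … can be chosen one
-- after another to make every E_n(u) vanish.

open import Defs
open import Level using (Level)
open import Data.Nat using (ℕ; zero; suc; _<_; _≤_; _∸_; z≤n; s≤s)
import Data.Nat as ℕ
import Data.Nat.Properties as ℕP
open import Data.Nat.Primality using (Prime; prime⇒irreducible; prime⇒nonZero)
open import Data.Nat.Coprimality using (Coprime; coprime-Bézout)
open import Data.Nat.GCD using (module Bézout)
open import Data.Nat.Divisibility using (∣⇒≤)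
open import Data.Integer using (+_; -_; -[1+_]) renaming (_+_ to _+ℤ_)
import Data.Integer as Int
import Data.Integer.Properties as IntP
open import Data.Product using (∃; _×_; _,_; proj₁; proj₂)
open import Data.Sum using (inj₁; inj₂)
open import Data.Empty using (⊥-elim)
open import Relation.Nullary using (¬_; yes; no)
import Relation.Binary.PropositionalEquality as P
open P using (_≡_)
import Relation.Binary.Reasoning.Setoid as SetoidReasoning
import Algebra.Solver.Ring.NaturalCoefficients.Default as RingSolver
import Algebra.Properties.Ring as RingProperties

split-index : ∀ N l → 1 ≤ l → l ≤ N ∸ 1 → ∃ λ n → 1 ≤ n × l ℕ.+ n ≡ N
split-index zero    (suc l) _ ()
split-index (suc N) l       _ l≤N =
  suc (N ∸ l) , s≤s z≤n , P.trans (ℕP.+-suc l (N ∸ l)) (P.cong suc (ℕP.m+[n∸m]≡n l≤N))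

module Development {p : ℕ} {c ℓ : Level} (K : FiniteFieldOver p c ℓ) where
  open FiniteFieldOver K renaming (-_ to neg)
  open FF K
  open RingOps field-ring using (fromℕ)
  open SetoidReasoning setoid
  open RingSolver commutativeSemiring using (solve; _:+_; _:*_; _:=_; con)

  Seq : Set c
  Seq = ℕ → Carrier

  sumTo-cong : ∀ n {f g : Seq} → (∀ i → i < n → f i ≈ g i) → sumTo n f ≈ sumTo n g
  sumTo-cong zero    f≈g = refl
  sumTo-cong (suc n) f≈g =
    +-cong (sumTo-cong n (λ i i<n → f≈g i (ℕP.m<n⇒m<1+n i<n))) (f≈g n (ℕP.n<1+n n))

  sumTo-zero : ∀ n {f : Seq} → (∀ i → i < n → f i ≈ 0#) → sumTo n f ≈ 0#
  sumTo-zero n {f} f≈0 = trans (sumTo-cong n f≈0) (zeros n)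
    where
    zeros : ∀ n → sumTo n (λ _ → 0#) ≈ 0#
    zeros zero    = refl
    zeros (suc n) = trans (+-identityʳ _) (zeros n)

  sumTo-first : ∀ n (f : Seq) → sumTo (suc n) f ≈ f 0 + sumTo n (λ i → f (suc i))
  sumTo-first zero    f = trans (+-identityˡ (f 0)) (sym (+-identityʳ (f 0)))
  sumTo-first (suc n) f = trans (+-cong (sumTo-first n f) refl) (+-assoc _ _ _)

  sumTo-split : ∀ a b (f : Seq) → sumTo (a ℕ.+ b) f ≈ sumTo a f + sumTo b (λ i → f (a ℕ.+ i))
  sumTo-split a zero    f rewrite ℕP.+-identityʳ a = sym (+-identityʳ _)
  sumTo-split a (suc b) f rewrite ℕP.+-suc a b =
    trans (+-cong (sumTo-split a b f) refl) (+-assoc _ _ _)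

  sumTo-scale : ∀ n a (f : Seq) → sumTo n (λ i → a * f i) ≈ a * sumTo n f
  sumTo-scale zero    a f = sym (zeroʳ a)
  sumTo-scale (suc n) a f = trans (+-cong (sumTo-scale n a f) refl) (sym (distribˡ a _ _))

  -- The Cauchy product: coefficients of the product of two power series.  It is
  -- definitionally the coefficient sequence computed by _·L_.
  infixl 7 _⋆_
  _⋆_ : Seq → Seq → Seq
  (f ⋆ g) n = sumTo (suc n) (λ j → f j * g (n ∸ j))

  ⋆-cong : ∀ n {f f′ g g′ : Seq} → (∀ i → i ≤ n → f i ≈ f′ i) → (∀ i → i ≤ n → g i ≈ g′ i) →
           (f ⋆ g) n ≈ (f′ ⋆ g′) n
  ⋆-cong n f≈ g≈ = sumTo-cong (suc n) λ i i≤n →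
    *-cong (f≈ i (ℕP.≤-pred i≤n)) (g≈ (n ∸ i) (ℕP.m∸n≤m n i))

  const-⋆ : ∀ a (g : Seq) n → (Laurent.coeffs (const a) ⋆ g) n ≈ a * g n
  const-⋆ a g n = trans (sumTo-first n _)
    (trans (+-cong refl (sumTo-zero n (λ i _ → zeroˡ _))) (+-identityʳ _))

  ⋆-shift : ∀ α β n (f g : Seq) → (∀ j → j < α → f j ≈ 0#) → (∀ j → j < β → g j ≈ 0#) →
            (f ⋆ g) (α ℕ.+ (β ℕ.+ n)) ≈ ((λ i → f (α ℕ.+ i)) ⋆ (λ i → g (β ℕ.+ i))) n
  ⋆-shift α β n f g f-low g-low = begin
    sumTo (suc D) F                                    ≡⟨ P.cong (λ q → sumTo q F) length ⟩
    sumTo (α ℕ.+ (suc n ℕ.+ β)) F                      ≈⟨ sumTo-split α _ F ⟩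
    sumTo α F + sumTo (suc n ℕ.+ β) G                  ≈⟨ +-cong (sumTo-zero α head) (sumTo-split (suc n) β G) ⟩
    0# + (sumTo (suc n) G + sumTo β (λ k → G (suc n ℕ.+ k)))
                                                       ≈⟨ +-identityˡ _ ⟩
    sumTo (suc n) G + sumTo β (λ k → G (suc n ℕ.+ k))  ≈⟨ +-cong refl (sumTo-zero β tail) ⟩
    sumTo (suc n) G + 0#                               ≈⟨ +-identityʳ _ ⟩
    sumTo (suc n) G                                    ≈⟨ sumTo-cong (suc n) middle ⟩
    ((λ i → f (α ℕ.+ i)) ⋆ (λ i → g (β ℕ.+ i))) n     ∎
    where
    D : ℕ
    D = α ℕ.+ (β ℕ.+ n)
    F : Seq
    F j = f j * g (D ∸ j)
    G : Seq
    G i = F (α ℕ.+ i)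
    length : suc D ≡ α ℕ.+ (suc n ℕ.+ β)
    length = P.trans (P.sym (ℕP.+-suc α (β ℕ.+ n))) (P.cong (λ q → α ℕ.+ suc q) (ℕP.+-comm β n))
    head : ∀ j → j < α → F j ≈ 0#
    head j j<α = trans (*-cong (f-low j j<α) refl) (zeroˡ _)
    tail : ∀ k → k < β → G (suc n ℕ.+ k) ≈ 0#
    tail k k<β = trans (*-cong refl (trans (reflexive (P.cong g index)) (g-low _ (bound β k<β)))) (zeroʳ _)
      where
      index : D ∸ (α ℕ.+ (suc n ℕ.+ k)) ≡ (β ℕ.+ n) ∸ (suc n ℕ.+ k)
      index = ℕP.[m+n]∸[m+o]≡n∸o α (β ℕ.+ n) (suc n ℕ.+ k)
      bound : ∀ β → k < β → (β ℕ.+ n) ∸ (suc n ℕ.+ k) < β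
      bound (suc β′) (s≤s k≤β′) rewrite ℕP.+-comm β′ n | ℕP.[m+n]∸[m+o]≡n∸o n β′ k =
        s≤s (ℕP.m∸n≤m β′ k)
    -- the remaining terms: D ∸ (α + i) = β + (n ∸ i) for i ≤ n
    middle : ∀ i → i < suc n → G i ≈ f (α ℕ.+ i) * g (β ℕ.+ (n ∸ i))
    middle i i<1+n = *-cong refl (reflexive (P.cong g
      (P.trans (ℕP.[m+n]∸[m+o]≡n∸o α (β ℕ.+ n) i) (ℕP.+-∸-assoc β (ℕP.≤-pred i<1+n)))))

  -- Coefficients of the ℓ-th power of the power series Σ_i d i · t^i; definitionally
  -- pw d (suc ℓ) = d ⋆ pw d ℓ.
  pw : Seq → ℕ → Seq
  pw d ℓ = Laurent.coeffs (powL (laurent 0 d) ℓ)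

  shift-powL : ∀ d ℓ → Laurent.shift (powL (laurent 0 d) ℓ) ≡ 0
  shift-powL d zero    = P.refl
  shift-powL d (suc ℓ) = shift-powL d ℓ

  pw-cong : ∀ ℓ k {u v : Seq} → (∀ i → i ≤ k → u i ≈ v i) → pw u ℓ k ≈ pw v ℓ k
  pw-cong zero    k u≈v = refl
  pw-cong (suc ℓ) k u≈v =
    ⋆-cong k u≈v (λ i i≤k → pw-cong ℓ i (λ j j≤i → u≈v j (ℕP.≤-trans j≤i i≤k)))

  pw-constant : ∀ ℓ {u : Seq} → u 0 ≈ 1# → pw u ℓ 0 ≈ 1#
  pw-constant zero    u₀ = refl
  pw-constant (suc ℓ) u₀ = trans (+-identityˡ _) (trans (*-cong u₀ (pw-constant ℓ u₀)) (*-identityˡ 1#))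

  pw-vanishes : ∀ ℓ {d : Seq} → d 0 ≈ 0# → ∀ j → j < ℓ → pw d ℓ j ≈ 0#
  pw-vanishes (suc ℓ) {d} d₀ j j≤ℓ = sumTo-zero (suc j) term
    where
    term : ∀ i → i < suc j → d i * pw d ℓ (j ∸ i) ≈ 0#
    term zero    _           = trans (*-cong d₀ refl) (zeroˡ _)
    term (suc i) (s≤s i<j) = trans (*-cong refl (pw-vanishes ℓ d₀ (j ∸ suc i) below)) (zeroʳ _)
      where
      below : j ∸ suc i < ℓ
      below = ℕP.<-≤-trans (ℕP.∸-monoʳ-< (s≤s z≤n) i<j) (ℕP.≤-pred j≤ℓ)

  pw-shift : ∀ ℓ k {d : Seq} → d 0 ≈ 0# → pw d ℓ (ℓ ℕ.+ k) ≈ pw (λ i → d (suc i)) ℓ k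
  pw-shift zero    k     d₀ = refl
  pw-shift (suc ℓ) k {d} d₀ = trans
    (⋆-shift 1 ℓ k d (pw d ℓ) (λ { zero _ → d₀ ; (suc _) (s≤s ()) }) (pw-vanishes ℓ d₀))
    (⋆-cong k (λ _ _ → refl) (λ i _ → pw-shift ℓ i {d} d₀))

  pw-top-linear : ∀ ℓ k (u v : Seq) → u 0 ≈ 1# → (∀ i → i < suc k → u i ≈ v i) → v (suc k) ≈ 0# →
                  pw u ℓ (suc k) ≈ fromℕ ℓ * u (suc k) + pw v ℓ (suc k)
  pw-top-linear zero    k u v u₀ u≈v v-top = sym (trans (+-identityʳ _) (zeroˡ _))
  pw-top-linear (suc ℓ) k u v u₀ u≈v v-top = begin
    sumTo (suc k) Fu + Fu (suc k)                      ≈⟨ +-cong (sumTo-first k Fu) top-u ⟩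
    (Fu 0 + sumTo k (λ i → Fu (suc i))) + x            ≈⟨ +-cong (+-cong first-u middle) refl ⟩
    ((fromℕ ℓ * x + Pv) + Mv) + x                      ≈⟨ regroup (fromℕ ℓ) x Pv Mv ⟩
    (1# + fromℕ ℓ) * x + ((Pv + Mv) + 0#)              ≈⟨ +-cong refl (+-cong (+-cong (sym first-v) refl) (sym top-v)) ⟩
    (1# + fromℕ ℓ) * x + ((Fv 0 + Mv) + Fv (suc k))    ≈⟨ +-cong refl (+-cong (sym (sumTo-first k Fv)) refl) ⟩
    (1# + fromℕ ℓ) * x + (sumTo (suc k) Fv + Fv (suc k)) ∎
    where
    x : Carrier
    x = u (suc k)
    Fu Fv : Seq
    Fu j = u j * pw u ℓ (suc k ∸ j)
    Fv j = v j * pw v ℓ (suc k ∸ j)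
    Pv Mv : Carrier
    Pv = pw v ℓ (suc k)
    Mv = sumTo k (λ i → Fv (suc i))
    regroup : ∀ L x P M → ((L * x + P) + M) + x ≈ (1# + L) * x + ((P + M) + 0#)
    regroup = solve 4 (λ L x P M → ((L :* x :+ P) :+ M) :+ x
                                 := (con 1 :+ L) :* x :+ ((P :+ M) :+ con 0)) refl
    -- the term u_(k+1) · (u^ℓ)_0 contributes x, the term v_(k+1) · … contributes 0
    top-u : Fu (suc k) ≈ x
    top-u = trans (*-cong refl (trans (reflexive (P.cong (pw u ℓ) (ℕP.n∸n≡0 k))) (pw-constant ℓ u₀))) (*-identityʳ x)
    top-v : Fv (suc k) ≈ 0#
    top-v = trans (*-cong v-top refl) (zeroˡ _)
    first-u : Fu 0 ≈ fromℕ ℓ * x + Pv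
    first-u = trans (*-cong u₀ (pw-top-linear ℓ k u v u₀ u≈v v-top)) (*-identityˡ _)
    first-v : Fv 0 ≈ Pv
    first-v = trans (*-cong (trans (sym (u≈v 0 (s≤s z≤n))) u₀) refl) (*-identityˡ _)
    -- all other terms only involve coefficients of index ≤ k, where u and v agree
    middle : sumTo k (λ i → Fu (suc i)) ≈ Mv
    middle = sumTo-cong k (λ i i<k → *-cong (u≈v (suc i) (s≤s i<k))
      (pw-cong ℓ (k ∸ i) (λ j j≤ → u≈v j (s≤s (ℕP.≤-trans j≤ (ℕP.m∸n≤m k i))))))

  fromℕ-+ : ∀ a b → fromℕ (a ℕ.+ b) ≈ fromℕ a + fromℕ b
  fromℕ-+ zero    b = sym (+-identityˡ _)
  fromℕ-+ (suc a) b = trans (+-cong refl (fromℕ-+ a b)) (sym (+-assoc _ _ _))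

  fromℕ-* : ∀ a b → fromℕ (a ℕ.* b) ≈ fromℕ a * fromℕ b
  fromℕ-* zero    b = sym (zeroˡ _)
  fromℕ-* (suc a) b = trans (fromℕ-+ b (a ℕ.* b))
    (trans (+-cong (sym (*-identityˡ _)) (fromℕ-* a b)) (sym (distribʳ _ _ _)))

  fromℕ-multiple : ∀ y → fromℕ (y ℕ.* p) ≈ 0#
  fromℕ-multiple y = trans (fromℕ-* y p) (trans (*-cong refl char-p) (zeroʳ _))

  -- For 0 < l < p the element l·1 of k is nonzero: l is invertible mod p (Bézout),
  -- so l·1 = 0 would force 1 = 0.
  fromℕ-nonzero : Prime p → ∀ l → 0 < l → l < p → ¬ fromℕ l ≈ 0#
  fromℕ-nonzero p-prime l 0<l l<p l≈0 with coprime-Bézout coprime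
    where
    coprime : Coprime l p
    coprime (d∣l , d∣p) with prime⇒irreducible p-prime d∣p
    ... | inj₁ d≡1   = d≡1
    ... | inj₂ P.refl = ⊥-elim (ℕP.<⇒≱ l<p (∣⇒≤ {{ℕ.>-nonZero 0<l}} d∣l))
  ... | Bézout.+- x y eq = 1≉0 (begin
    1#                      ≈⟨ sym (+-identityʳ 1#) ⟩
    1# + 0#                 ≈⟨ +-cong refl (sym (fromℕ-multiple y)) ⟩
    fromℕ (1 ℕ.+ y ℕ.* p)   ≡⟨ P.cong fromℕ eq ⟩
    fromℕ (x ℕ.* l)         ≈⟨ fromℕ-* x l ⟩
    fromℕ x * fromℕ l       ≈⟨ *-cong refl l≈0 ⟩
    fromℕ x * 0#            ≈⟨ zeroʳ _ ⟩
    0#                      ∎)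
  ... | Bézout.-+ x y eq = 1≉0 (begin
    1#                      ≈⟨ sym (+-identityʳ 1#) ⟩
    1# + 0#                 ≈⟨ +-cong refl (sym (trans (fromℕ-* x l) (trans (*-cong refl l≈0) (zeroʳ _)))) ⟩
    fromℕ (1 ℕ.+ x ℕ.* l)   ≡⟨ P.cong fromℕ eq ⟩
    fromℕ (y ℕ.* p)         ≈⟨ fromℕ-multiple y ⟩
    0#                      ∎)

  nonzero-* : ∀ a b → ¬ a ≈ 0# → ¬ b ≈ 0# → ¬ a * b ≈ 0#
  nonzero-* a b a≉0 b≉0 ab≈0 = b≉0 (begin
    b             ≈⟨ sym (*-identityˡ b) ⟩
    1# * b        ≈⟨ *-cong (sym (trans (*-comm _ _) (proj₂ (inverse a a≉0)))) refl ⟩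
    (a⁻¹ * a) * b ≈⟨ *-assoc _ _ _ ⟩
    a⁻¹ * (a * b) ≈⟨ *-cong refl ab≈0 ⟩
    a⁻¹ * 0#      ≈⟨ zeroʳ _ ⟩
    0#            ∎)
    where
    a⁻¹ : Carrier
    a⁻¹ = proj₁ (inverse a a≉0)

  -- Tr 0 = 0, since each summand 0^(p^j) has positive exponent.
  Tr-zero : Prime p → ∀ x → x ≈ 0# → Tr x ≈ 0#
  Tr-zero p-prime x x≈0 = sumTo-zero degree (λ j _ → power (p ℕ.^ j) (ℕP.m^n>0 p {{prime⇒nonZero p-prime}} j))
    where
    power : ∀ n → 0 < n → pow x n ≈ 0#
    power (suc n) _ = trans (*-cong x≈0 refl) (zeroˡ _)

  -- A total inverse (0 at 0), so that the recursive choice below is defined at every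
  -- step regardless of whether the slope is invertible there.
  inv0 : Carrier → Carrier
  inv0 x with x ≟ 0#
  ... | yes _   = 0#
  ... | no x≉0 = proj₁ (inverse x x≉0)

  solve-linear : ∀ a e → ¬ a ≈ 0# → a * neg (inv0 a * e) + e ≈ 0#
  solve-linear a e a≉0 = begin
    a * neg (inv0 a * e) + e   ≈⟨ +-cong (sym (-‿distribʳ-* a _)) refl ⟩
    neg (a * (inv0 a * e)) + e ≈⟨ +-cong (-‿cong (sym (*-assoc _ _ _))) refl ⟩
    neg ((a * inv0 a) * e) + e ≈⟨ +-cong (-‿cong (trans (*-cong (right-inverse a≉0) refl) (*-identityˡ e))) refl ⟩
    neg e + e                  ≈⟨ -‿inverseˡ e ⟩
    0#                         ∎
    where
    open RingProperties ring using (-‿distribʳ-*)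
    right-inverse : ¬ a ≈ 0# → a * inv0 a ≈ 1#
    right-inverse a≉0 with a ≟ 0#
    ... | yes a≈0  = ⊥-elim (a≉0 a≈0)
    ... | no a≉0′ = proj₂ (inverse a a≉0′)

  override : Seq → ℕ → Carrier → Seq
  override w n y i with i ℕ.≟ n
  ... | yes _ = y
  ... | no _  = w i

  override-here : ∀ w n y → override w n y n ≡ y
  override-here w n y with n ℕ.≟ n
  ... | yes _  = P.refl
  ... | no n≢n = ⊥-elim (n≢n P.refl)

  override-elsewhere : ∀ w n y i → ¬ i ≡ n → override w n y i ≡ w i
  override-elsewhere w n y i i≢n with i ℕ.≟ n
  ... | yes i≡n = ⊥-elim (i≢n i≡n)
  ... | no _    = P.refl

  override-cong : ∀ w w′ n y i → (¬ i ≡ n → w i ≈ w′ i) → override w n y i ≈ override w′ n y i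
  override-cong w w′ n y i w≈ with i ℕ.≟ n
  ... | yes _   = refl
  ... | no i≢n = w≈ i≢n

  module Recursion (N : ℕ) (b : Seq) where
    E : ℕ → Seq → Carrier
    E n w = (b ⋆ pw w (N ∸ n)) n

    E₀ : ℕ → Seq → Carrier
    E₀ n w = E n (override w n 0#)

    slope : ℕ → Carrier
    slope n = b 0 * fromℕ (N ∸ n)

    -- approx n is correct at positions ≤ n; position n is chosen to solve
    -- slope n · u_n + E₀ n u = 0 (later positions are irrelevant).
    approx : ℕ → Seq
    approx zero    = λ _ → 1#
    approx (suc n) = override (approx n) (suc n) (neg (inv0 (slope (suc n)) * E₀ (suc n) (approx n)))

    u : Seq
    u i = approx i i

    approx-stable : ∀ n i → i ≤ n → approx n i ≡ u i
    approx-stable zero    zero z≤n = P.refl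
    approx-stable (suc n) i i≤1+n with ℕP.m≤n⇒m<n∨m≡n i≤1+n
    ... | inj₂ P.refl      = P.refl
    ... | inj₁ (s≤s i≤n) =
      P.trans (override-elsewhere _ (suc n) _ i (ℕP.<⇒≢ (s≤s i≤n))) (approx-stable n i i≤n)

    E-cong : ∀ n w w′ → (∀ i → i ≤ n → w i ≈ w′ i) → E n w ≈ E n w′
    E-cong n w w′ w≈ = ⋆-cong n (λ _ _ → refl) (λ i i≤n → pw-cong (N ∸ n) i (λ j j≤i → w≈ j (ℕP.≤-trans j≤i i≤n)))

    E-linear : ∀ k w → w 0 ≈ 1# → E (suc k) w ≈ slope (suc k) * w (suc k) + E₀ (suc k) w
    E-linear k w w₀ = begin
      sumTo (suc n) Fw                                        ≈⟨ sumTo-first n Fw ⟩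
      b 0 * pw w L n + Rest Fw                                ≈⟨ +-cong (*-cong refl (pw-top-linear L k w w′ w₀ agree top)) rest ⟩
      b 0 * (fromℕ L * w n + pw w′ L n) + Rest Fw′            ≈⟨ regroup (b 0) (fromℕ L) (w n) _ _ ⟩
      slope n * w n + (b 0 * pw w′ L n + Rest Fw′)            ≈⟨ +-cong refl (sym (sumTo-first n Fw′)) ⟩
      slope n * w n + E₀ n w                                  ∎
      where
      n L : ℕ
      n = suc k
      L = N ∸ n
      w′ : Seq
      w′ = override w n 0#
      Fw Fw′ : Seq
      Fw j  = b j * pw w L (n ∸ j)
      Fw′ j = b j * pw w′ L (n ∸ j)
      Rest : Seq → Carrier
      Rest F = sumTo n (λ i → F (suc i))
      regroup : ∀ b L x P R → b * (L * x + P) + R ≈ (b * L) * x + (b * P + R)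
      regroup = solve 5 (λ b L x P R → b :* (L :* x :+ P) :+ R := (b :* L) :* x :+ (b :* P :+ R)) refl
      top : w′ n ≈ 0#
      top = reflexive (override-here w n 0#)
      agree : ∀ i → i < n → w i ≈ w′ i
      agree i i<n = sym (reflexive (override-elsewhere w n 0# i (ℕP.<⇒≢ i<n)))
      rest : Rest Fw ≈ Rest Fw′
      rest = sumTo-cong n (λ i i<n → *-cong refl
        (pw-cong L (k ∸ i) (λ j j≤ → agree j (s≤s (ℕP.≤-trans j≤ (ℕP.m∸n≤m k i))))))

    E-vanishes : ∀ k → ¬ slope (suc k) ≈ 0# → E (suc k) u ≈ 0#
    E-vanishes k slope≉0 = begin
      E n u                                 ≈⟨ E-linear k u refl ⟩
      slope n * u n + E₀ n u                ≈⟨ +-cong (*-cong refl (reflexive (override-here (approx k) n _))) same-E₀ ⟩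
      slope n * neg (inv0 (slope n) * e) + e ≈⟨ solve-linear (slope n) e slope≉0 ⟩
      0#                                    ∎
      where
      n : ℕ
      n = suc k
      e : Carrier
      e = E₀ n (approx k)
      same-E₀ : E₀ n u ≈ e
      same-E₀ = E-cong n _ _ (λ i i≤n → override-cong u (approx k) n 0# i
        (λ i≢n → reflexive (P.sym (approx-stable k i (ℕP.≤-pred (ℕP.≤∧≢⇒< i≤n i≢n))))))

  solvable : Prime p → ∀ N (b : Seq) → ¬ b 0 ≈ 0# → N < p →
    ∃ λ (u : Seq) → u 0 ≈ 1# × (∀ l n → 1 ≤ l → 1 ≤ n → l ℕ.+ n ≡ N → (b ⋆ pw u l) n ≈ 0#)
  solvable p-prime N b b₀≉0 N<p = u , refl , vanish
    where
    open Recursion N b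
    vanish : ∀ l n → 1 ≤ l → 1 ≤ n → l ℕ.+ n ≡ N → (b ⋆ pw u l) n ≈ 0#
    vanish l (suc k) 1≤l _ P.refl = P.subst (λ q → (b ⋆ pw u q) (suc k) ≈ 0#) exponent (E-vanishes k slope≉0)
      where
      exponent : (l ℕ.+ suc k) ∸ suc k ≡ l
      exponent = ℕP.m+n∸n≡m l (suc k)
      slope≉0 : ¬ slope (suc k) ≈ 0#
      slope≉0 = nonzero-* _ _ b₀≉0 (P.subst (λ q → ¬ fromℕ q ≈ 0#) (P.sym exponent)
        (fromℕ-nonzero p-prime l 1≤l (ℕP.≤-<-trans (ℕP.m≤m+n l (suc k)) N<p)))

  coef-at : ∀ s (f : Seq) e j → e +ℤ (+ s) ≡ + j → coef (laurent s f) e ≡ f j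
  coef-at s f e j eq rewrite eq = P.refl

  coef-minus-one : ∀ s (f : Seq) j → s ≡ suc j → coef (laurent s f) -[1+ 0 ] ≡ f j
  coef-minus-one s f j P.refl = P.refl

  exponent-of : ∀ m′ j w → -[1+ m′ ℕ.+ w ] +ℤ + suc (m′ ℕ.+ (j ℕ.+ w)) ≡ + j
  exponent-of m′ j w = P.trans (IntP.[1+m]⊖[1+n]≡m⊖n (m′ ℕ.+ (j ℕ.+ w)) (m′ ℕ.+ w))
    (P.trans (IntP.+-cancelˡ-⊖ m′ (j ℕ.+ w) w)
    (P.trans (IntP.⊖-≥ (ℕP.m≤n+m w j)) (P.cong +_ (ℕP.m+n∸n≡m j w))))

  -- Normal form of a series of order exactly -(m′+1): its coefficient list starts with
  -- r zeros followed by the leading coefficient, and its shift is m′ + 1 + r; i.e.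
  -- z = t^(-(m′+1)) · b with b_i = coeffs (r + i) and b_0 ≠ 0.
  normal-form : ∀ (z : Laurent) m′ →
    (∀ i → i Int.< -[1+ m′ ] → coef z i ≈ 0#) → ¬ coef z -[1+ m′ ] ≈ 0# →
    ∃ λ r → Laurent.shift z ≡ suc (m′ ℕ.+ r) × (∀ j → j < r → Laurent.coeffs z j ≈ 0#)
          × ¬ Laurent.coeffs z (r ℕ.+ 0) ≈ 0#
  normal-form (laurent s f) m′ below leading with suc m′ ℕ.≤? s
  ... | no s≤m′ = ⊥-elim (leading (reflexive (coef-before-start (ℕP.≰⇒> s≤m′))))
    where
    -- if s ≤ m′ then the exponent -(m′+1) lies before the stored coefficients
    coef-before-start : s < suc m′ → coef (laurent s f) -[1+ m′ ] ≡ 0#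
    coef-before-start s<1+m′ rewrite IntP.⊖-< s<1+m′ | ℕP.+-∸-assoc 1 (ℕP.≤-pred s<1+m′) = P.refl
  ... | yes m′<s = r , shape , zeros , lead
    where
    r : ℕ
    r = s ∸ suc m′
    shape : s ≡ suc (m′ ℕ.+ r)
    shape = P.sym (ℕP.m+[n∸m]≡n m′<s)
    lead : ¬ f (r ℕ.+ 0) ≈ 0#
    lead f≈0 = leading (trans (reflexive coefficient) f≈0)
      where
      coefficient : coef (laurent s f) -[1+ m′ ] ≡ f (r ℕ.+ 0)
      coefficient = P.trans (coef-at s f -[1+ m′ ] r (IntP.⊖-≥ m′<s)) (P.cong f (P.sym (ℕP.+-identityʳ r)))
    zeros : ∀ j → j < r → f j ≈ 0#
    zeros j j<r = trans (sym (reflexive (coef-at s f e j exponent))) (below e (Int.-<- (ℕP.m<m+n m′ 0<w)))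
      where
      w : ℕ
      w = r ∸ j
      0<w : 0 < w
      0<w = ℕP.m<n⇒0<n∸m j<r
      e : Int.ℤ
      e = -[1+ m′ ℕ.+ w ]
      exponent : e +ℤ + s ≡ + j
      exponent = P.trans (P.cong (λ q → e +ℤ + q) shape)
        (P.trans (P.cong (λ q → e +ℤ + suc (m′ ℕ.+ q)) (P.sym (ℕP.m+[n∸m]≡n (ℕP.<⇒≤ j<r))))
                 (exponent-of m′ j w))

  times-t : Seq → Seq
  times-t u zero    = 0#
  times-t u (suc i) = u i

  residue : ∀ (z : Laurent) r N l n (u : Seq) a →
    Laurent.shift z ≡ suc (N ℕ.+ r) → (∀ j → j < r → Laurent.coeffs z j ≈ 0#) → l ℕ.+ n ≡ N →
    coef (z ·L (const a ·L powL (laurent 0 (times-t u)) l)) -[1+ 0 ] ≈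
      a * ((λ i → Laurent.coeffs z (r ℕ.+ i)) ⋆ pw u l) n
  residue (laurent s f) r N l n u a shape zeros P.refl = begin
    coef (laurent (s ℕ.+ shift-t) (f ⋆ Q)) -[1+ 0 ]     ≡⟨ coef-minus-one _ (f ⋆ Q) _ total-shift ⟩
    (f ⋆ Q) ((l ℕ.+ n) ℕ.+ r)                          ≡⟨ P.cong (f ⋆ Q) (ℕP.+-comm (l ℕ.+ n) r) ⟩
    (f ⋆ Q) (r ℕ.+ (l ℕ.+ n))                          ≈⟨ ⋆-shift r l n f Q zeros Q-low ⟩
    (b ⋆ (λ i → Q (l ℕ.+ i))) n                        ≈⟨ ⋆-cong n (λ _ _ → refl) (λ i _ → Q-shift i) ⟩
    (b ⋆ (λ i → a * pw u l i)) n                       ≈⟨ sumTo-cong (suc n) (λ j _ → swap (b j) a _) ⟩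
    sumTo (suc n) (λ j → a * (b j * pw u l (n ∸ j)))   ≈⟨ sumTo-scale (suc n) a _ ⟩
    a * (b ⋆ pw u l) n                                 ∎
    where
    d : Seq
    d = times-t u
    shift-t : ℕ
    shift-t = Laurent.shift (powL (laurent 0 d) l)
    b Q : Seq
    b i = f (r ℕ.+ i)
    Q = Laurent.coeffs (const a) ⋆ pw d l
    total-shift : s ℕ.+ shift-t ≡ suc ((l ℕ.+ n) ℕ.+ r)
    total-shift = P.trans (P.cong (s ℕ.+_) (shift-powL d l)) (P.trans (ℕP.+-identityʳ s) shape)
    Q-low : ∀ j → j < l → Q j ≈ 0#
    Q-low j j<l = trans (const-⋆ a (pw d l) j) (trans (*-cong refl (pw-vanishes l refl j j<l)) (zeroʳ a))
    Q-shift : ∀ i → Q (l ℕ.+ i) ≈ a * pw u l i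
    Q-shift i = trans (const-⋆ a (pw d l) (l ℕ.+ i)) (*-cong refl (pw-shift l i refl))
    swap : ∀ x a y → x * (a * y) ≈ a * (x * y)
    swap = solve 3 (λ x a y → x :* (a :* y) := a :* (x :* y)) refl

lemma4p2 : {c ℓ : Level} (p : ℕ) → Prime p → (K : FiniteFieldOver p c ℓ) →
    (m : ℕ) → m < p → 2 < m →
    (z : FF.Laurent K) →
    (∀ i → i Data.Integer.< - (+ m) → FiniteFieldOver._≈_ K (FF.coef K z i) (FiniteFieldOver.0# K)) →
    ¬ FiniteFieldOver._≈_ K (FF.coef K z (- (+ m))) (FiniteFieldOver.0# K) →
    ∃ λ (t₁ : FF.Laurent K) → FF.HasOrd K t₁ (+ 1) ×
    (∀ (ℓ′ : ℕ) → 1 ≤ ℓ′ → ℓ′ ≤ m ∸ 2 → ∀ (a : FiniteFieldOver.Carrier K) →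
    FF.ψ[_]≡1 K z (FF._·L_ K (FF.const K a) (FF.powL K t₁ ℓ′)))
-- With m = N + 1: put z in normal form z = t^(-m) · b, choose u for (N, b), take t₁ = t · u.
lemma4p2 p p-prime K (suc N) m<p (s≤s _) z below leading
  with Development.normal-form K z N below leading
... | r , shape , zeros , b₀≉0
  with Development.solvable K p-prime N (λ i → FF.Laurent.coeffs z (r ℕ.+ i)) b₀≉0 (ℕP.≤-pred (ℕP.m<n⇒m<1+n m<p))
... | u , u₀≈1 , vanish = t₁ , order-one , residues-vanish
  where
  open FiniteFieldOver K
  open FF K
  open Development K using (times-t; residue; Tr-zero)
  t₁ : Laurent
  t₁ = laurent 0 (times-t u)
  order-one : HasOrd t₁ (+ 1)
  order-one = (λ { (+ 0) _ → refl ; (+ suc _) (Int.+<+ (s≤s ())) ; -[1+ _ ] _ → refl })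
            , (λ u₀≈0 → 1≉0 (trans (sym u₀≈1) u₀≈0))
  residues-vanish : ∀ l → 1 ≤ l → l ≤ N ∸ 1 → ∀ a → ψ[ z ]≡1 (const a ·L powL t₁ l)
  residues-vanish l 1≤l l≤N-1 a with split-index N l 1≤l l≤N-1
  ... | n , 1≤n , l+n≡N = Tr-zero p-prime _ (trans (residue z r N l n u a shape zeros l+n≡N)
          (trans (*-cong refl (vanish l n 1≤l 1≤n l+n≡N)) (zeroʳ a)))
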